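{- Let $m$ be a positive integer, $n$ an odd positive integer, $q=2^m$, $u\in\mathbb{F}_{2^m}^*$ and $v\in\mathbb{F}_{2^m}\setminus\{0,1\}$. Writing $T=\mathrm{tr}_m^{nm}(x)$, the polynomial \begin{align*} \tilde F(x)&=\left(1+T^{q-1}\right)\sum_{j=0}^{m-1}\frac{u^{2^j-1}}{v^{2^{j+1}-1}}\left(\sum_{k=0}^{\frac{n-1}{2}}x^{q^{2k}}\right)^{2^j} +\left[T^{q-1}+\left(u\,\mathrm{tr}_m^{nm}(x^2)+v^2T\right)^{q-1}\right]\left(\frac{x}{u}\right)^{1/2}\\ &\quad+\left(u\,\mathrm{tr}_m^{nm}(x^2)+v^2T\right)^{q-1}\left[\frac{T}{v}+u^{1/2}\sum_{j=0}^{m-1}\left(\frac{uT+v^2}{u^{1/2}v}\right)^{ -(2^{j+1}-1)}\left(\sum_{k=0}^{\frac{n-1}{2}}x^{q^{2k}}\right)^{2^j}\right] \end{align*} is a complete permutation polynomial over $\mathbb{F}_{2^{nm}}$.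
   Context: A polynomial $f\in\mathbb{F}_Q[x]$ is a complete permutation polynomial over $\mathbb{F}_Q$ if both $f(x)$ and $f(x)+x$ induce bijections of $\mathbb{F}_Q$. $\mathrm{tr}_m^{nm}(x)=\sum_{i=0}^{n-1}x^{2^{mi}}$ is the relative trace from $\mathbb{F}_{2^{nm}}$ to $\mathbb{F}_{2^m}$. In polynomials over $\mathbb{F}_{2^e}$ (here $e=nm$), $x^{1/2}$ denotes $x^{2^{e-1}}$ and $1/x$ denotes $x^{2^e-2}$ (so $1/0=0$); accordingly $y^{ -k}=(1/y)^k$. -}

module Defs where

import Data.Nat
open import Data.Nat using (ℕ; zero; suc; _∸_; _^_) renaming (_+_ to _+ℕ_; _*_ to _*ℕ_)
open import Data.Fin using (Fin)
open import Data.Product using (_×_; ∃)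
open import Relation.Nullary using (¬_)
open import Relation.Binary.PropositionalEquality using (_≡_)
open import Algebra.Structures using (IsCommutativeRing)
open import Function.Bundles using (_↔_)
open import Function.Definitions using (Bijective)

record FiniteField (Q : ℕ) : Set₁ where
  infixl 6 _+_
  infixl 7 _*_
  field
    Carrier : Set
    _+_ _*_ : Carrier → Carrier → Carrier
    -_      : Carrier → Carrier
    0# 1#   : Carrier
    isCommutativeRing : IsCommutativeRing _≡_ _+_ _*_ -_ 0# 1#
    0≢1     : ¬ (0# ≡ 1#)
    inverse : ∀ x → ¬ (x ≡ 0#) → ∃ λ y → x * y ≡ 1#
    enum    : Carrier ↔ Fin Q

module FieldOps {Q : ℕ} (K : FiniteField Q) where
  open FiniteField K

  pow : Carrier → ℕ → Carrier
  pow x zero    = 1#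
  pow x (suc k) = x * pow x k

  sumBelow : ℕ → (ℕ → Carrier) → Carrier
  sumBelow zero    f = 0#
  sumBelow (suc N) f = sumBelow N f + f N

  IsCPP : (Carrier → Carrier) → Set
  IsCPP f = Bijective _≡_ _≡_ f × Bijective _≡_ _≡_ (λ x → f x + x)

module Corollary11Poly (m n : ℕ) (K : FiniteField (2 ^ (n *ℕ m))) where
  open FiniteField K
  open FieldOps K

  e : ℕ
  e = n *ℕ m

  q : ℕ
  q = 2 ^ m

  inv : Carrier → Carrier
  inv y = pow y (2 ^ e ∸ 2)

  sqrt : Carrier → Carrier
  sqrt y = pow y (2 ^ (e ∸ 1))

  tr : Carrier → Carrier
  tr x = sumBelow n (λ i → pow x (2 ^ (m *ℕ i)))

  S : Carrier → Carrier
  S x = sumBelow (suc ((n ∸ 1) Data.Nat./ 2)) (λ k → pow x (q ^ (2 *ℕ k)))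

  Ftilde : Carrier → Carrier → Carrier → Carrier
  Ftilde u v x =
      (1# + pow T (q ∸ 1))
        * sumBelow m (λ j → pow u (2 ^ j ∸ 1) * inv (pow v (2 ^ (suc j) ∸ 1))
                             * pow (S x) (2 ^ j))
    + (pow T (q ∸ 1) + pow W (q ∸ 1)) * sqrt (x * inv u)
    + pow W (q ∸ 1)
        * (T * inv v
           + sqrt u * sumBelow m (λ j →
                pow (inv ((u * T + pow v 2) * inv (sqrt u * v))) (2 ^ (suc j) ∸ 1)
                * pow (S x) (2 ^ j)))
    where
      T : Carrier
      T = tr x
      W : Carrier
      W = u * tr (pow x 2) + pow v 2 * T

module Submission where

-- Put T = tr x and W = u T² + v² T, both in 𝔽q. On each of the regions T = 0, (T ≠ 0, W = 0)
-- and (T ≠ 0, W ≠ 0) the polynomial F̃ is a single expression: a linearised polynomial A in S x,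
-- the square root of x / u, and T / v + √u B with B linearised in S x. As n is odd,
-- S x + (S x)^q = x + T, and a telescoping sum shows that these invert y ↦ u y² + v y, y ↦ u y²
-- and y ↦ y² + c(T) y + T respectively. In every region tr F̃(x) = T / v, so F̃(x) determines T,
-- the region and then x. For F̃(x) + x, of trace T (1/v + 1), two preimages of a value lie in the
-- same region and the difference of their F̃- (or B-) values is a trace-zero root of a quadratic
-- over 𝔽q; a nonzero root lies in 𝔽q, where tr is the identity, so the difference vanishes.

open import Defs
open import Data.Nat as ℕ using (ℕ; zero; suc; _∸_; _%_; _/_) renaming (_+_ to _+ℕ_; _*_ to _*ℕ_)
import Data.Nat.Properties as ℕP
import Data.Nat.DivMod as ℕDM
open import Data.Fin as Fin using (Fin)
import Data.Fin.Properties as FinP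
open import Data.Fin.Permutation using (Permutation; permutation)
open import Data.Bool using (Bool; true; false; _xor_; _∧_)
import Data.Bool.Properties as BoolP
open import Data.Maybe using (Maybe; just; nothing)
open import Data.Product using (_,_; ∃; proj₁; proj₂)
open import Data.Sum using (_⊎_; inj₁; inj₂)
open import Data.Empty using (⊥-elim)
open import Data.Vec.Functional using (removeAt)
open import Relation.Nullary using (¬_; Dec; yes; no)
open import Relation.Binary.PropositionalEquality
open import Function.Bundles using (Inverse)
open import Function.Definitions using (Bijective; Injective)
open import Function.Consequences.Propositional using (strictlySurjective⇒surjective)
open import Algebra.Bundles using (CommutativeRing; RawRing)
import Algebra.Properties.CommutativeMonoid.Sum as MonoidSum
import Algebra.Properties.CommutativeSemigroup as CommSemigroupProps
import Algebra.Properties.Ring as RingProps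
import Algebra.Properties.Group as GroupProps
import Algebra.Solver.Ring.AlmostCommutativeRing as ACR

odd⇒≡1+[[n∸1]/2]*2 : ∀ n → n % 2 ≡ 1 → n ≡ suc (((n ∸ 1) / 2) *ℕ 2)
odd⇒≡1+[[n∸1]/2]*2 n n%2≡1 = trans n≡1+[n/2]*2 (cong (λ k → suc (k *ℕ 2)) (sym [n∸1]/2≡n/2))
  where
    n≡1+[n/2]*2 : n ≡ suc ((n / 2) *ℕ 2)
    n≡1+[n/2]*2 = trans (ℕDM.m≡m%n+[m/n]*n n 2) (cong (_+ℕ (n / 2) *ℕ 2) n%2≡1)
    [n∸1]/2≡n/2 : (n ∸ 1) / 2 ≡ n / 2
    [n∸1]/2≡n/2 = trans (cong (λ k → (k ∸ 1) / 2) n≡1+[n/2]*2) (ℕDM.m*n/n≡m (n / 2) 2)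

1≤n⇒n≡1+[n∸1] : ∀ {n} → 1 ℕ.≤ n → n ≡ suc (n ∸ 1)
1≤n⇒n≡1+[n∸1] {suc n} _ = refl

2^j≡1+[2^j∸1] : ∀ j → 2 ℕ.^ j ≡ suc (2 ℕ.^ j ∸ 1)
2^j≡1+[2^j∸1] j = 1≤n⇒n≡1+[n∸1] (ℕP.m^n>0 2 j)

2^[1+j]∸1≡1+[2^j∸1]*2 : ∀ j → 2 ℕ.^ suc j ∸ 1 ≡ suc ((2 ℕ.^ j ∸ 1) *ℕ 2)
2^[1+j]∸1≡1+[2^j∸1]*2 j = begin
    2 ℕ.^ suc j ∸ 1    ≡⟨ cong (λ z → 2 *ℕ z ∸ 1) (2^j≡1+[2^j∸1] j) ⟩
    2 *ℕ suc t ∸ 1     ≡⟨ ℕP.+-suc t (t +ℕ 0) ⟩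
    suc (2 *ℕ t)       ≡⟨ cong suc (ℕP.*-comm 2 t) ⟩
    suc (t *ℕ 2)       ∎
  where
    open ≡-Reasoning
    t = 2 ℕ.^ j ∸ 1

Fin-injective⇒surjective : ∀ {k} (g : Fin k → Fin k) → Injective _≡_ _≡_ g → ∀ y → ∃ λ i → g i ≡ y
Fin-injective⇒surjective {suc k} g g-inj y with FinP.any? (λ i → g i FinP.≟ y)
... | yes hit = hit
... | no miss = ⊥-elim (ℕP.1+n≰n (FinP.injective⇒≤ punchOut∘g-injective))
  where
    punchOut∘g : Fin (suc k) → Fin k
    punchOut∘g i = Fin.punchOut {i = y} {j = g i} (λ eq → miss (i , sym eq))
    punchOut∘g-injective : Injective _≡_ _≡_ punchOut∘g
    punchOut∘g-injective {i} {j} eq =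
      g-inj (FinP.punchOut-injective {i = y} (λ e → miss (i , sym e)) (λ e → miss (j , sym e)) eq)

module FiniteFieldProperties {Q : ℕ} (K : FiniteField Q) where
  open FiniteField K
  open FieldOps K

  ring : CommutativeRing _ _
  ring = record { isCommutativeRing = isCommutativeRing }

  open CommutativeRing ring public
    using (+-comm; +-assoc; *-comm; *-assoc; +-identityˡ; +-identityʳ; *-identityˡ; *-identityʳ;
           zeroˡ; zeroʳ; distribˡ; -‿inverseʳ)
  open CommutativeRing ring using (*-commutativeMonoid; *-commutativeSemigroup)
  module Π = MonoidSum *-commutativeMonoid

  toFin : Carrier → Fin Q
  toFin = Inverse.to enum

  fromFin : Fin Q → Carrier
  fromFin = Inverse.from enum

  toFin∘fromFin : ∀ i → toFin (fromFin i) ≡ i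
  toFin∘fromFin = Inverse.strictlyInverseˡ enum

  fromFin∘toFin : ∀ x → fromFin (toFin x) ≡ x
  fromFin∘toFin = Inverse.strictlyInverseʳ enum

  infix 4 _≟_
  _≟_ : (x y : Carrier) → Dec (x ≡ y)
  x ≟ y with toFin x Fin.≟ toFin y
  ... | yes eq = yes (trans (sym (fromFin∘toFin x)) (trans (cong fromFin eq) (fromFin∘toFin y)))
  ... | no neq = no (λ eq → neq (cong toFin eq))

  injective⇒bijective : (f : Carrier → Carrier) → Injective _≡_ _≡_ f → Bijective _≡_ _≡_ f
  injective⇒bijective f f-inj = f-inj , strictlySurjective⇒surjective f-onto
    where
      f̂ : Fin Q → Fin Q
      f̂ i = toFin (f (fromFin i))
      f̂-inj : Injective _≡_ _≡_ f̂
      f̂-inj {i} {j} eq = trans (sym (toFin∘fromFin i)) (trans (cong toFin (f-inj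
        (trans (sym (fromFin∘toFin _)) (trans (cong fromFin eq) (fromFin∘toFin _))))) (toFin∘fromFin j))
      f-onto : ∀ y → ∃ λ x → f x ≡ y
      f-onto y with Fin-injective⇒surjective f̂ f̂-inj (toFin y)
      ... | i , f̂i≡y = fromFin i , trans (sym (fromFin∘toFin _)) (trans (cong fromFin f̂i≡y) (fromFin∘toFin y))

  1≢0 : ¬ 1# ≡ 0#
  1≢0 eq = 0≢1 (sym eq)

  *-cancelˡ : ∀ {a x y} → ¬ a ≡ 0# → a * x ≡ a * y → x ≡ y
  *-cancelˡ {a} {x} {y} a≢0 ax≡ay = begin
      x              ≡⟨ sym (*-identityʳ x) ⟩
      x * 1#         ≡⟨ cong (x *_) (sym ab≡1) ⟩
      x * (a * b)    ≡⟨ sym (*-assoc x a b) ⟩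
      (x * a) * b    ≡⟨ cong (_* b) (trans (*-comm x a) (trans ax≡ay (*-comm a y))) ⟩
      (y * a) * b    ≡⟨ *-assoc y a b ⟩
      y * (a * b)    ≡⟨ cong (y *_) ab≡1 ⟩
      y * 1#         ≡⟨ *-identityʳ y ⟩
      y              ∎
    where
      open ≡-Reasoning
      b = proj₁ (inverse a a≢0)
      ab≡1 = proj₂ (inverse a a≢0)

  x*y≡0⇒x≡0⊎y≡0 : ∀ {x y} → x * y ≡ 0# → x ≡ 0# ⊎ y ≡ 0#
  x*y≡0⇒x≡0⊎y≡0 {x} {y} xy≡0 with x ≟ 0#
  ... | yes x≡0 = inj₁ x≡0
  ... | no x≢0 = inj₂ (*-cancelˡ x≢0 (trans xy≡0 (sym (zeroʳ x))))

  *-≢0 : ∀ {x y} → ¬ x ≡ 0# → ¬ y ≡ 0# → ¬ x * y ≡ 0#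
  *-≢0 x≢0 y≢0 xy≡0 with x*y≡0⇒x≡0⊎y≡0 xy≡0
  ... | inj₁ x≡0 = x≢0 x≡0
  ... | inj₂ y≡0 = y≢0 y≡0

  pow-+ : ∀ x a b → pow x (a +ℕ b) ≡ pow x a * pow x b
  pow-+ x zero b = sym (*-identityˡ _)
  pow-+ x (suc a) b = trans (cong (x *_) (pow-+ x a b)) (sym (*-assoc x _ _))

  pow-distrib-* : ∀ x y a → pow (x * y) a ≡ pow x a * pow y a
  pow-distrib-* x y zero = sym (*-identityˡ 1#)
  pow-distrib-* x y (suc a) = trans (cong ((x * y) *_) (pow-distrib-* x y a))
    (CommSemigroupProps.interchange *-commutativeSemigroup x y (pow x a) (pow y a))

  pow-1# : ∀ b → pow 1# b ≡ 1#
  pow-1# zero = refl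
  pow-1# (suc b) = trans (*-identityˡ _) (pow-1# b)

  pow-* : ∀ x a b → pow x (a *ℕ b) ≡ pow (pow x a) b
  pow-* x zero b = sym (pow-1# b)
  pow-* x (suc a) b = trans (pow-+ x b (a *ℕ b))
    (trans (cong (pow x b *_) (pow-* x a b)) (sym (pow-distrib-* x (pow x a) b)))

  pow-comm : ∀ x a b → pow (pow x a) b ≡ pow (pow x b) a
  pow-comm x a b = trans (sym (pow-* x a b)) (trans (cong (pow x) (ℕP.*-comm a b)) (pow-* x b a))

  pow-≢0 : ∀ {x} b → ¬ x ≡ 0# → ¬ pow x b ≡ 0#
  pow-≢0 zero x≢0 = 1≢0
  pow-≢0 (suc b) x≢0 = *-≢0 x≢0 (pow-≢0 b x≢0)

  -- Fermat: scaling by a ≠ 0 permutes the field, and multiplies the product of the units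
  -- (with 0 counted as 1) by a ^ (Q - 1).
  private
    unitPart : Carrier → Carrier
    unitPart x with x ≟ 0#
    ... | yes _ = 1#
    ... | no _ = x

    scaleFactor : Carrier → Carrier → Carrier
    scaleFactor a x with x ≟ 0#
    ... | yes _ = 1#
    ... | no _ = a

    unitPart-≢0 : ∀ x → ¬ unitPart x ≡ 0#
    unitPart-≢0 x with x ≟ 0#
    ... | yes _ = 1≢0
    ... | no x≢0 = x≢0

    unitPart-* : ∀ {a} → ¬ a ≡ 0# → ∀ x → unitPart (a * x) ≡ scaleFactor a x * unitPart x
    unitPart-* {a} a≢0 x with x ≟ 0# | a * x ≟ 0#
    ... | yes _ | yes _ = sym (*-identityˡ 1#)
    ... | yes x≡0 | no ax≢0 = ⊥-elim (ax≢0 (trans (cong (a *_) x≡0) (zeroʳ a)))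
    ... | no x≢0 | yes ax≡0 = ⊥-elim (*-≢0 a≢0 x≢0 ax≡0)
    ... | no _ | no _ = refl

    ∏-≢0 : ∀ {k} (f : Fin k → Carrier) → (∀ i → ¬ f i ≡ 0#) → ¬ Π.sum f ≡ 0#
    ∏-≢0 {zero} f f≢0 = 1≢0
    ∏-≢0 {suc k} f f≢0 = *-≢0 (f≢0 Fin.zero) (∏-≢0 (λ i → f (Fin.suc i)) (λ i → f≢0 (Fin.suc i)))

    ∏-const : ∀ k a → Π.sum {k} (λ _ → a) ≡ pow a k
    ∏-const zero a = refl
    ∏-const (suc k) a = cong (a *_) (∏-const k a)

    ∏-all-but-one : ∀ {k} (i₀ : Fin k) (t : Fin k → Carrier) (a : Carrier) →
      t i₀ ≡ 1# → (∀ j → ¬ j ≡ i₀ → t j ≡ a) → Π.sum t * a ≡ pow a k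
    ∏-all-but-one {suc k} i₀ t a t[i₀]≡1 t≡a = begin
        Π.sum t * a                         ≡⟨ cong (_* a) (Π.sum-remove {i = i₀} t) ⟩
        (t i₀ * Π.sum (removeAt t i₀)) * a  ≡⟨ cong (λ z → (z * Π.sum (removeAt t i₀)) * a) t[i₀]≡1 ⟩
        (1# * Π.sum (removeAt t i₀)) * a    ≡⟨ cong (_* a) (*-identityˡ _) ⟩
        Π.sum (removeAt t i₀) * a           ≡⟨ cong (_* a) (Π.sum-cong-≗ (λ j → t≡a (Fin.punchIn i₀ j) (FinP.punchInᵢ≢i i₀ j))) ⟩
        Π.sum {k} (λ _ → a) * a             ≡⟨ cong (_* a) (∏-const k a) ⟩
        pow a k * a                         ≡⟨ *-comm _ a ⟩
        pow a (suc k)                       ∎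
      where open ≡-Reasoning

    module _ {a : Carrier} (a≢0 : ¬ a ≡ 0#) where
      a⁻¹ : Carrier
      a⁻¹ = proj₁ (inverse a a≢0)

      cancel : ∀ b c x → b * c ≡ 1# → b * (c * x) ≡ x
      cancel b c x bc≡1 = trans (sym (*-assoc b c x)) (trans (cong (_* x) bc≡1) (*-identityˡ x))

      scaling : Permutation Q Q
      scaling = permutation (λ i → toFin (a * fromFin i)) (λ i → toFin (a⁻¹ * fromFin i))
        (λ i → trans (cong (λ z → toFin (a * z)) (fromFin∘toFin _))
               (trans (cong toFin (cancel a a⁻¹ _ (proj₂ (inverse a a≢0)))) (toFin∘fromFin i)))
        (λ i → trans (cong (λ z → toFin (a⁻¹ * z)) (fromFin∘toFin _))
               (trans (cong toFin (cancel a⁻¹ a _ (trans (*-comm a⁻¹ a) (proj₂ (inverse a a≢0))))) (toFin∘fromFin i)))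

      P Φ : Carrier
      P = Π.sum (λ i → unitPart (fromFin i))
      Φ = Π.sum (λ i → scaleFactor a (fromFin i))

      P≡Φ*P : P ≡ Φ * P
      P≡Φ*P = begin
          P                                                   ≡⟨ Π.sum-permute (λ i → unitPart (fromFin i)) scaling ⟩
          Π.sum (λ i → unitPart (fromFin (toFin (a * fromFin i))))
            ≡⟨ Π.sum-cong-≗ (λ i → trans (cong unitPart (fromFin∘toFin _)) (unitPart-* a≢0 (fromFin i))) ⟩
          Π.sum (λ i → scaleFactor a (fromFin i) * unitPart (fromFin i))
            ≡⟨ Π.∑-distrib-+ (λ i → scaleFactor a (fromFin i)) (λ i → unitPart (fromFin i)) ⟩
          Φ * P                                               ∎
        where open ≡-Reasoning

      Φ≡1 : Φ ≡ 1#
      Φ≡1 = sym (*-cancelˡ (∏-≢0 _ (λ i → unitPart-≢0 (fromFin i)))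
                  (trans (*-identityʳ P) (trans P≡Φ*P (*-comm Φ P))))

      scaleFactor-at-0 : scaleFactor a (fromFin (toFin 0#)) ≡ 1#
      scaleFactor-at-0 rewrite fromFin∘toFin 0# with 0# ≟ 0#
      ... | yes _ = refl
      ... | no 0≢0 = ⊥-elim (0≢0 refl)

      scaleFactor-elsewhere : ∀ j → ¬ j ≡ toFin 0# → scaleFactor a (fromFin j) ≡ a
      scaleFactor-elsewhere j j≢0 with fromFin j ≟ 0#
      ... | yes j≡0 = ⊥-elim (j≢0 (trans (sym (toFin∘fromFin j)) (cong toFin j≡0)))
      ... | no _ = refl

      pow-Q-≢0 : pow a Q ≡ a
      pow-Q-≢0 = trans (sym (∏-all-but-one (toFin 0#) (λ i → scaleFactor a (fromFin i)) a scaleFactor-at-0 scaleFactor-elsewhere))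
                       (trans (cong (_* a) Φ≡1) (*-identityˡ a))

  pow-Q : ∀ a → pow a Q ≡ a
  pow-Q a with a ≟ 0#
  ... | yes a≡0 = trans (cong (λ z → pow z Q) a≡0) (trans (pow0 (toFin 0#)) (sym a≡0))
    where
      pow0 : ∀ {k} → Fin k → pow 0# k ≡ 0#
      pow0 {suc k} _ = zeroˡ _
  ... | no a≢0 = pow-Q-≢0 a≢0

  2^[1+r]⇒1+1≡0 : ∀ r → Q ≡ 2 ℕ.^ suc r → 1# + 1# ≡ 0#
  2^[1+r]⇒1+1≡0 r Q≡2^[1+r] = trans (cong (1# +_) (sym -1≡1)) (-‿inverseʳ 1#)
    where
      open ≡-Reasoning
      -1²≡1 : pow (- 1#) 2 ≡ 1#
      -1²≡1 = trans (cong (- 1# *_) (*-identityʳ (- 1#)))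
        (trans (RingProps.-1*x≈-x (CommutativeRing.ring ring) (- 1#))
               (GroupProps.⁻¹-involutive (CommutativeRing.+-group ring) 1#))
      -1≡1 : - 1# ≡ 1#
      -1≡1 = begin
          - 1#                          ≡⟨ sym (pow-Q (- 1#)) ⟩
          pow (- 1#) Q                  ≡⟨ cong (pow (- 1#)) Q≡2^[1+r] ⟩
          pow (- 1#) (2 *ℕ 2 ℕ.^ r)     ≡⟨ pow-* (- 1#) 2 (2 ℕ.^ r) ⟩
          pow (pow (- 1#) 2) (2 ℕ.^ r)  ≡⟨ cong (λ z → pow z (2 ℕ.^ r)) -1²≡1 ⟩
          pow 1# (2 ℕ.^ r)              ≡⟨ pow-1# (2 ℕ.^ r) ⟩
          1#                            ∎

module Characteristic2 {Q : ℕ} (K : FiniteField Q) (1+1≡0 : FiniteField._+_ K (FiniteField.1# K) (FiniteField.1# K) ≡ FiniteField.0# K) where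
  open FiniteField K
  open FieldOps K
  open FiniteFieldProperties K public

  private
    bitRing : RawRing _ _
    bitRing = record { Carrier = Bool ; _≈_ = _≡_ ; _+_ = _xor_ ; _*_ = _∧_ ; -_ = λ b → b ; 0# = false ; 1# = true }

    ⟦_⟧ : Bool → Carrier
    ⟦ true ⟧ = 1#
    ⟦ false ⟧ = 0#

    bitsInto : bitRing ACR.-Raw-AlmostCommutative⟶ ACR.fromCommutativeRing ring
    bitsInto = record
      { ⟦_⟧ = ⟦_⟧
      ; +-homo = λ { false false → sym (+-identityˡ 0#) ; false true → sym (+-identityˡ 1#)
                   ; true false → sym (+-identityʳ 1#) ; true true → sym 1+1≡0 }
      ; *-homo = λ { false false → sym (zeroˡ 0#) ; false true → sym (zeroˡ 1#)
                   ; true false → sym (zeroʳ 1#) ; true true → sym (*-identityˡ 1#) }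
      ; -‿homo = λ { false → sym (GroupProps.ε⁻¹≈ε (CommutativeRing.+-group ring))
                   ; true → GroupProps.inverseʳ-unique (CommutativeRing.+-group ring) 1# 1# 1+1≡0 }
      ; 0-homo = refl
      ; 1-homo = refl
      }

    bits≟ : ∀ a b → Maybe (⟦ a ⟧ ≡ ⟦ b ⟧)
    bits≟ a b with a BoolP.≟ b
    ... | yes a≡b = just (cong ⟦_⟧ a≡b)
    ... | no _ = nothing

  -- Ring normalisation with coefficients in 𝔽₂, so the identities may use x + x = 0.
  open import Algebra.Solver.Ring bitRing (ACR.fromCommutativeRing ring) bitsInto bits≟ public
    using (solve; _:=_; _:+_; _:*_; con)

  x+x≡0 : ∀ x → x + x ≡ 0#
  x+x≡0 = solve 1 (λ x → x :+ x := con false) refl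

  x+y≡0⇒x≡y : ∀ {x y} → x + y ≡ 0# → x ≡ y
  x+y≡0⇒x≡y {x} {y} x+y≡0 = begin
      x              ≡⟨ solve 2 (λ x y → x := (x :+ y) :+ y) refl x y ⟩
      (x + y) + y    ≡⟨ cong (_+ y) x+y≡0 ⟩
      0# + y         ≡⟨ +-identityˡ y ⟩
      y              ∎
    where open ≡-Reasoning

  x≡y⇒x+y≡0 : ∀ {x y} → x ≡ y → x + y ≡ 0#
  x≡y⇒x+y≡0 {x} refl = x+x≡0 x

  +-cancelʳ : ∀ {x y} z → x + z ≡ y + z → x ≡ y
  +-cancelʳ {x} {y} z x+z≡y+z = x+y≡0⇒x≡y (trans (solve 3 (λ x y z → x :+ y := (x :+ z) :+ (y :+ z)) refl x y z)
                                                  (x≡y⇒x+y≡0 x+z≡y+z))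

  pow-2 : ∀ x → pow x 2 ≡ x * x
  pow-2 x = cong (x *_) (*-identityʳ x)

  frob : ℕ → Carrier → Carrier
  frob k x = pow x (2 ℕ.^ k)

  frob-0 : ∀ x → frob 0 x ≡ x
  frob-0 = *-identityʳ

  frob-suc : ∀ k x → frob (suc k) x ≡ frob k (pow x 2)
  frob-suc k x = pow-* x 2 (2 ℕ.^ k)

  frob-+ℕ : ∀ a b x → frob (a +ℕ b) x ≡ frob b (frob a x)
  frob-+ℕ a b x = trans (cong (pow x) (ℕP.^-distribˡ-+-* 2 a b)) (pow-* x (2 ℕ.^ a) (2 ℕ.^ b))

  frob-comm : ∀ a b x → frob a (frob b x) ≡ frob b (frob a x)
  frob-comm a b x = pow-comm x (2 ℕ.^ b) (2 ℕ.^ a)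

  frob-sucˡ : ∀ j x → frob 1 (frob j x) ≡ frob (suc j) x
  frob-sucˡ j x = trans (sym (frob-+ℕ j 1 x)) (cong (λ k → frob k x) (ℕP.+-comm j 1))

  pow-2-+ : ∀ x y → pow (x + y) 2 ≡ pow x 2 + pow y 2
  pow-2-+ x y = trans (pow-2 (x + y)) (trans (solve 2 (λ x y → (x :+ y) :* (x :+ y) := x :* x :+ y :* y) refl x y)
                  (sym (cong₂ _+_ (pow-2 x) (pow-2 y))))

  frob-+ : ∀ k x y → frob k (x + y) ≡ frob k x + frob k y
  frob-+ zero x y = trans (frob-0 _) (sym (cong₂ _+_ (frob-0 x) (frob-0 y)))
  frob-+ (suc k) x y = begin
      frob (suc k) (x + y)                 ≡⟨ frob-suc k (x + y) ⟩
      frob k (pow (x + y) 2)               ≡⟨ cong (frob k) (pow-2-+ x y) ⟩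
      frob k (pow x 2 + pow y 2)           ≡⟨ frob-+ k _ _ ⟩
      frob k (pow x 2) + frob k (pow y 2)  ≡⟨ sym (cong₂ _+_ (frob-suc k x) (frob-suc k y)) ⟩
      frob (suc k) x + frob (suc k) y      ∎
    where open ≡-Reasoning

  frob-1# : ∀ k → frob k 1# ≡ 1#
  frob-1# k = pow-1# (2 ℕ.^ k)

  frob-* : ∀ k x y → frob k (x * y) ≡ frob k x * frob k y
  frob-* k x y = pow-distrib-* x y (2 ℕ.^ k)

  frob-pow : ∀ k a x → frob k (pow x a) ≡ pow (frob k x) a
  frob-pow k a x = pow-comm x a (2 ℕ.^ k)

  frob≡x*pow[2^k∸1] : ∀ k x → frob k x ≡ x * pow x (2 ℕ.^ k ∸ 1)
  frob≡x*pow[2^k∸1] k x = cong (pow x) (2^j≡1+[2^j∸1] k)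

  frob-0# : ∀ k → frob k 0# ≡ 0#
  frob-0# k = trans (frob≡x*pow[2^k∸1] k 0#) (zeroˡ _)

  pow[2^[1+j]∸1] : ∀ j x → pow x (2 ℕ.^ suc j ∸ 1) ≡ x * pow (pow x (2 ℕ.^ j ∸ 1)) 2
  pow[2^[1+j]∸1] j x = trans (cong (pow x) (2^[1+j]∸1≡1+[2^j∸1]*2 j)) (cong (x *_) (pow-* x (2 ℕ.^ j ∸ 1) 2))

  pow-2-injective : ∀ {a b} → pow a 2 ≡ pow b 2 → a ≡ b
  pow-2-injective {a} {b} a²≡b² with x*y≡0⇒x≡0⊎y≡0 {a + b} {a + b}
      (trans (sym (pow-2 (a + b))) (trans (pow-2-+ a b) (x≡y⇒x+y≡0 a²≡b²)))
  ... | inj₁ a+b≡0 = x+y≡0⇒x≡y a+b≡0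
  ... | inj₂ a+b≡0 = x+y≡0⇒x≡y a+b≡0

  sumBelow-cong : ∀ N {f g} → (∀ i → f i ≡ g i) → sumBelow N f ≡ sumBelow N g
  sumBelow-cong zero f≗g = refl
  sumBelow-cong (suc N) f≗g = cong₂ _+_ (sumBelow-cong N f≗g) (f≗g N)

  sumBelow-+ : ∀ N f g → sumBelow N (λ i → f i + g i) ≡ sumBelow N f + sumBelow N g
  sumBelow-+ zero f g = sym (+-identityʳ 0#)
  sumBelow-+ (suc N) f g = trans (cong (_+ (f N + g N)) (sumBelow-+ N f g))
    (solve 4 (λ a b c d → (a :+ b) :+ (c :+ d) := (a :+ c) :+ (b :+ d)) refl _ _ _ _)

  additive-sumBelow : (h : Carrier → Carrier) → (∀ x y → h (x + y) ≡ h x + h y) → h 0# ≡ 0# →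
                      ∀ N f → h (sumBelow N f) ≡ sumBelow N (λ i → h (f i))
  additive-sumBelow h h-+ h-0 zero f = h-0
  additive-sumBelow h h-+ h-0 (suc N) f = trans (h-+ _ _) (cong (_+ h (f N)) (additive-sumBelow h h-+ h-0 N f))

  *-distribˡ-sumBelow : ∀ a N f → a * sumBelow N f ≡ sumBelow N (λ i → a * f i)
  *-distribˡ-sumBelow a = additive-sumBelow (a *_) (distribˡ a) (zeroʳ a)

  frob-sumBelow : ∀ k N f → frob k (sumBelow N f) ≡ sumBelow N (λ i → frob k (f i))
  frob-sumBelow k = additive-sumBelow (frob k) (frob-+ k) (frob-0# k)

  sumBelow-0# : ∀ N → sumBelow N (λ _ → 0#) ≡ 0#
  sumBelow-0# zero = refl
  sumBelow-0# (suc N) = trans (+-identityʳ _) (sumBelow-0# N)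

  sumBelow-odd-const : ∀ h a → sumBelow (suc (h *ℕ 2)) (λ _ → a) ≡ a
  sumBelow-odd-const zero a = +-identityˡ a
  sumBelow-odd-const (suc h) a = trans (cong (λ z → (z + a) + a) (sumBelow-odd-const h a))
    (solve 1 (λ a → (a :+ a) :+ a := a) refl a)

  sumBelow-const≡0⊎a : ∀ N a → sumBelow N (λ _ → a) ≡ 0# ⊎ sumBelow N (λ _ → a) ≡ a
  sumBelow-const≡0⊎a zero a = inj₁ refl
  sumBelow-const≡0⊎a (suc N) a with sumBelow-const≡0⊎a N a
  ... | inj₁ ≡0 = inj₂ (trans (cong (_+ a) ≡0) (+-identityˡ a))
  ... | inj₂ ≡a = inj₁ (trans (cong (_+ a) ≡a) (x+x≡0 a))

  telescope : ∀ N (g : ℕ → Carrier) → sumBelow N (λ j → g (suc j) + g j) ≡ g N + g 0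
  telescope zero g = sym (x+x≡0 (g 0))
  telescope (suc N) g = trans (cong (_+ (g (suc N) + g N)) (telescope N g))
    (solve 3 (λ a b c → (a :+ b) :+ (c :+ a) := c :+ b) refl (g N) (g 0) (g (suc N)))

  sumBelow-shift : ∀ N (g : ℕ → Carrier) → sumBelow N (λ i → g (suc i)) + g 0 ≡ sumBelow N g + g N
  sumBelow-shift zero g = refl
  sumBelow-shift (suc N) g = begin
      (sumBelow N (λ i → g (suc i)) + g (suc N)) + g 0  ≡⟨ solve 3 (λ a b c → (a :+ b) :+ c := (a :+ c) :+ b) refl _ _ _ ⟩
      (sumBelow N (λ i → g (suc i)) + g 0) + g (suc N)  ≡⟨ cong (_+ g (suc N)) (sumBelow-shift N g) ⟩
      (sumBelow N g + g N) + g (suc N)                  ∎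
    where open ≡-Reasoning

  sumBelow-pairs : ∀ N (g : ℕ → Carrier) → sumBelow N (λ k → g (k *ℕ 2) + g (suc (k *ℕ 2))) ≡ sumBelow (N *ℕ 2) g
  sumBelow-pairs zero g = refl
  sumBelow-pairs (suc N) g = trans (cong (_+ (g (N *ℕ 2) + g (suc (N *ℕ 2)))) (sumBelow-pairs N g))
    (sym (+-assoc _ _ _))

  -- α L² + β L = Σ_j (g (j+1) + g j) with g j = β c_j s^{2^j}, which telescopes.
  linearised-telescope : ∀ N (c : ℕ → Carrier) (α β s : Carrier) →
    (∀ j → α * pow (c j) 2 ≡ β * c (suc j)) → β * c N ≡ 1# → β * c 0 ≡ 1# →
    α * pow (sumBelow N (λ j → c j * frob j s)) 2 + β * sumBelow N (λ j → c j * frob j s) ≡ frob N s + s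
  linearised-telescope N c α β s c-rec βc[N]≡1 βc[0]≡1 = begin
      α * pow L 2 + β * L
        ≡⟨ cong₂ _+_ (cong (α *_) L²) (*-distribˡ-sumBelow β N _) ⟩
      α * sumBelow N (λ j → pow (c j) 2 * frob (suc j) s) + sumBelow N g
        ≡⟨ cong (_+ sumBelow N g) (trans (*-distribˡ-sumBelow α N _) (sumBelow-cong N (λ j →
             trans (sym (*-assoc α _ _)) (trans (cong (_* frob (suc j) s) (c-rec j)) (*-assoc β _ _))))) ⟩
      sumBelow N (λ j → g (suc j)) + sumBelow N g   ≡⟨ sym (sumBelow-+ N _ _) ⟩
      sumBelow N (λ j → g (suc j) + g j)            ≡⟨ telescope N g ⟩
      g N + g 0                                     ≡⟨ cong₂ _+_ (unit βc[N]≡1) (trans (unit βc[0]≡1) (frob-0 s)) ⟩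
      frob N s + s                                  ∎
    where
      open ≡-Reasoning
      L = sumBelow N (λ j → c j * frob j s)
      g : ℕ → Carrier
      g j = β * (c j * frob j s)
      L² : pow L 2 ≡ sumBelow N (λ j → pow (c j) 2 * frob (suc j) s)
      L² = trans (frob-sumBelow 1 N _) (sumBelow-cong N (λ j →
             trans (frob-* 1 (c j) (frob j s)) (cong (pow (c j) 2 *_) (frob-sucˡ j s))))
      unit : ∀ {j} → β * c j ≡ 1# → g j ≡ frob j s
      unit {j} βc≡1 = trans (sym (*-assoc β _ _)) (trans (cong (_* frob j s) βc≡1) (*-identityˡ _))

module Corollary11Proof (m n : ℕ) (1≤m : 1 ℕ.≤ m) (n-odd : n % 2 ≡ 1) (K : FiniteField (2 ℕ.^ (n *ℕ m))) where
  open FiniteField K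
  open FieldOps K
  open Corollary11Poly m n K

  h : ℕ
  h = (n ∸ 1) / 2

  n≡1+h*2 : n ≡ suc (h *ℕ 2)
  n≡1+h*2 = odd⇒≡1+[[n∸1]/2]*2 n n-odd

  m≡1+[m∸1] : m ≡ suc (m ∸ 1)
  m≡1+[m∸1] = 1≤n⇒n≡1+[n∸1] 1≤m

  e≡1+[e∸1] : e ≡ suc (e ∸ 1)
  e≡1+[e∸1] = 1≤n⇒n≡1+[n∸1] (subst (1 ℕ.≤_) (sym (cong₂ _*ℕ_ n≡1+h*2 m≡1+[m∸1])) (ℕ.s≤s ℕ.z≤n))

  open Characteristic2 K (FiniteFieldProperties.2^[1+r]⇒1+1≡0 K (e ∸ 1) (cong (2 ℕ.^_) e≡1+[e∸1]))

  frob-m*n : ∀ x → frob (m *ℕ n) x ≡ x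
  frob-m*n x = trans (cong (λ k → frob k x) (ℕP.*-comm m n)) (pow-Q x)

  frob-m*i+m : ∀ i x → frob m (frob (m *ℕ i) x) ≡ frob (m *ℕ suc i) x
  frob-m*i+m i x = trans (sym (frob-+ℕ (m *ℕ i) m x))
    (cong (λ k → frob k x) (trans (ℕP.+-comm (m *ℕ i) m) (sym (ℕP.*-suc m i))))

  𝔽q : Carrier → Set
  𝔽q a = frob m a ≡ a

  𝔽q-+ : ∀ {a b} → 𝔽q a → 𝔽q b → 𝔽q (a + b)
  𝔽q-+ {a} {b} a∈ b∈ = trans (frob-+ m a b) (cong₂ _+_ a∈ b∈)

  𝔽q-* : ∀ {a b} → 𝔽q a → 𝔽q b → 𝔽q (a * b)
  𝔽q-* {a} {b} a∈ b∈ = trans (frob-* m a b) (cong₂ _*_ a∈ b∈)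

  𝔽q-pow : ∀ {a} k → 𝔽q a → 𝔽q (pow a k)
  𝔽q-pow {a} k a∈ = trans (frob-pow m k a) (cong (λ z → pow z k) a∈)

  𝔽q-1# : 𝔽q 1#
  𝔽q-1# = frob-1# m

  𝔽q-inv : ∀ {a} → 𝔽q a → 𝔽q (inv a)
  𝔽q-inv = 𝔽q-pow (2 ℕ.^ e ∸ 2)

  𝔽q-sqrt : ∀ {a} → 𝔽q a → 𝔽q (sqrt a)
  𝔽q-sqrt = 𝔽q-pow (2 ℕ.^ (e ∸ 1))

  𝔽q⇒frob[m*i]≡id : ∀ {a} i → 𝔽q a → frob (m *ℕ i) a ≡ a
  𝔽q⇒frob[m*i]≡id {a} zero a∈ = trans (cong (λ k → frob k a) (ℕP.*-zeroʳ m)) (frob-0 a)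
  𝔽q⇒frob[m*i]≡id {a} (suc i) a∈ = trans (sym (frob-m*i+m i a))
    (trans (cong (frob m) (𝔽q⇒frob[m*i]≡id i a∈)) a∈)

  𝔽q-pow[q∸1] : ∀ {a} → 𝔽q a → ¬ a ≡ 0# → pow a (q ∸ 1) ≡ 1#
  𝔽q-pow[q∸1] {a} a∈ a≢0 = *-cancelˡ a≢0 (trans (trans (sym (cong (pow a) (2^j≡1+[2^j∸1] m))) a∈) (sym (*-identityʳ a)))

  0#-pow[q∸1] : pow 0# (q ∸ 1) ≡ 0#
  0#-pow[q∸1] = subst (λ k → pow 0# k ≡ 0#) (sym q∸1≡suc) (zeroˡ _)
    where
      q∸1≡suc : q ∸ 1 ≡ suc ((2 ℕ.^ (m ∸ 1) ∸ 1) *ℕ 2)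
      q∸1≡suc = trans (cong (λ k → 2 ℕ.^ k ∸ 1) m≡1+[m∸1]) (2^[1+j]∸1≡1+[2^j∸1]*2 (m ∸ 1))

  tr-+ : ∀ x y → tr (x + y) ≡ tr x + tr y
  tr-+ x y = trans (sumBelow-cong n (λ i → frob-+ (m *ℕ i) x y)) (sumBelow-+ n _ _)

  tr-0# : tr 0# ≡ 0#
  tr-0# = trans (sumBelow-cong n (λ i → frob-0# (m *ℕ i))) (sumBelow-0# n)

  tr-sumBelow : ∀ N f → tr (sumBelow N f) ≡ sumBelow N (λ i → tr (f i))
  tr-sumBelow = additive-sumBelow tr tr-+ tr-0#

  tr-*ˡ : ∀ {a} x → 𝔽q a → tr (a * x) ≡ a * tr x
  tr-*ˡ {a} x a∈ = trans (sumBelow-cong n (λ i → trans (frob-* (m *ℕ i) a x) (cong (_* frob (m *ℕ i) x) (𝔽q⇒frob[m*i]≡id i a∈))))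
                     (sym (*-distribˡ-sumBelow a n _))

  tr-frob : ∀ k x → tr (frob k x) ≡ frob k (tr x)
  tr-frob k x = trans (sumBelow-cong n (λ i → frob-comm (m *ℕ i) k x)) (sym (frob-sumBelow k n _))

  tr-𝔽q : ∀ x → 𝔽q (tr x)
  tr-𝔽q x = +-cancelʳ x (begin
      frob m (tr x) + x                                ≡⟨ cong₂ _+_ (trans (frob-sumBelow m n _) (sumBelow-cong n (λ i → frob-m*i+m i x)))
                                                                    (sym (trans (cong (λ k → frob k x) (ℕP.*-zeroʳ m)) (frob-0 x))) ⟩
      sumBelow n (λ i → g (suc i)) + g 0               ≡⟨ sumBelow-shift n g ⟩
      tr x + g n                                       ≡⟨ cong (tr x +_) (frob-m*n x) ⟩
      tr x + x                                         ∎)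
    where
      open ≡-Reasoning
      g : ℕ → Carrier
      g i = frob (m *ℕ i) x

  tr-on-𝔽q : ∀ {a} → 𝔽q a → tr a ≡ a
  tr-on-𝔽q {a} a∈ = trans (sumBelow-cong n (λ i → 𝔽q⇒frob[m*i]≡id i a∈))
    (subst (λ N → sumBelow N (λ _ → a) ≡ a) (sym n≡1+h*2) (sumBelow-odd-const h a))

  tr-linearised : ∀ N (c : ℕ → Carrier) s → (∀ j → 𝔽q (c j)) →
    tr (sumBelow N (λ j → c j * frob j s)) ≡ sumBelow N (λ j → c j * frob j (tr s))
  tr-linearised N c s c∈ = trans (tr-sumBelow N _)
    (sumBelow-cong N (λ j → trans (tr-*ˡ (frob j s) (c∈ j)) (cong (c j *_) (tr-frob j s))))

  S≡Σfrob : ∀ x → S x ≡ sumBelow (suc h) (λ k → frob (m *ℕ (k *ℕ 2)) x)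
  S≡Σfrob x = sumBelow-cong (suc h) (λ k → cong (pow x) (trans (ℕP.^-*-assoc 2 m (2 *ℕ k))
    (cong (λ i → 2 ℕ.^ (m *ℕ i)) (ℕP.*-comm 2 k))))

  -- The q-th power shifts the even-indexed conjugates of x in S x to the odd-indexed ones.
  S+S^q≡x+tr : ∀ x → S x + frob m (S x) ≡ x + tr x
  S+S^q≡x+tr x = begin
      S x + frob m (S x)
        ≡⟨ cong₂ _+_ (S≡Σfrob x) (trans (cong (frob m) (S≡Σfrob x))
             (trans (frob-sumBelow m (suc h) _) (sumBelow-cong (suc h) (λ k → frob-m*i+m (k *ℕ 2) x)))) ⟩
      sumBelow (suc h) (λ k → g (k *ℕ 2)) + sumBelow (suc h) (λ k → g (suc (k *ℕ 2)))
        ≡⟨ sym (sumBelow-+ (suc h) _ _) ⟩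
      sumBelow (suc h) (λ k → g (k *ℕ 2) + g (suc (k *ℕ 2)))  ≡⟨ sumBelow-pairs (suc h) g ⟩
      sumBelow (suc (suc (h *ℕ 2))) g                        ≡⟨ cong (λ N → sumBelow (suc N) g) (sym n≡1+h*2) ⟩
      tr x + g n                                             ≡⟨ cong (tr x +_) (frob-m*n x) ⟩
      tr x + x                                               ≡⟨ +-comm (tr x) x ⟩
      x + tr x                                               ∎
    where
      open ≡-Reasoning
      g : ℕ → Carrier
      g i = frob (m *ℕ i) x

  tr-S : ∀ x → tr (S x) ≡ sumBelow (suc h) (λ _ → tr x)
  tr-S x = trans (cong tr (S≡Σfrob x)) (trans (tr-sumBelow (suc h) _)
    (sumBelow-cong (suc h) (λ k → trans (tr-frob (m *ℕ (k *ℕ 2)) x) (𝔽q⇒frob[m*i]≡id (k *ℕ 2) (tr-𝔽q x)))))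

  x*inv≡1 : ∀ {a} → ¬ a ≡ 0# → a * inv a ≡ 1#
  x*inv≡1 {a} a≢0 = *-cancelˡ a≢0 (begin
      a * (a * inv a)             ≡⟨⟩
      pow a (2 +ℕ (2 ℕ.^ e ∸ 2))  ≡⟨ cong (pow a) (ℕP.m+[n∸m]≡n (ℕP.^-monoʳ-≤ 2 {1} {e} (subst (1 ℕ.≤_) (sym e≡1+[e∸1]) (ℕ.s≤s ℕ.z≤n)))) ⟩
      pow a (2 ℕ.^ e)             ≡⟨ pow-Q a ⟩
      a                           ≡⟨ sym (*-identityʳ a) ⟩
      a * 1#                      ∎)
    where open ≡-Reasoning

  inv*x≡1 : ∀ {a} → ¬ a ≡ 0# → inv a * a ≡ 1#
  inv*x≡1 a≢0 = trans (*-comm _ _) (x*inv≡1 a≢0)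

  inv-unique : ∀ {a b} → a * b ≡ 1# → b ≡ inv a
  inv-unique {a} {b} ab≡1 = *-cancelˡ a≢0 (trans ab≡1 (sym (x*inv≡1 a≢0)))
    where
      a≢0 : ¬ a ≡ 0#
      a≢0 a≡0 = 1≢0 (trans (sym ab≡1) (trans (cong (_* b) a≡0) (zeroˡ b)))

  inv-involutive : ∀ {a} → ¬ a ≡ 0# → inv (inv a) ≡ a
  inv-involutive a≢0 = sym (inv-unique (inv*x≡1 a≢0))

  inv-≢0 : ∀ {a} → ¬ a ≡ 0# → ¬ inv a ≡ 0#
  inv-≢0 {a} a≢0 inv≡0 = 1≢0 (trans (sym (x*inv≡1 a≢0)) (trans (cong (a *_) inv≡0) (zeroʳ a)))

  inv-distrib-* : ∀ a b → inv (a * b) ≡ inv a * inv b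
  inv-distrib-* a b = pow-distrib-* a b (2 ℕ.^ e ∸ 2)

  inv-pow : ∀ a k → inv (pow a k) ≡ pow (inv a) k
  inv-pow a k = pow-comm a k (2 ℕ.^ e ∸ 2)

  sqrt² : ∀ a → pow (sqrt a) 2 ≡ a
  sqrt² a = trans (sym (pow-* a (2 ℕ.^ (e ∸ 1)) 2))
    (trans (cong (pow a) (trans (ℕP.*-comm (2 ℕ.^ (e ∸ 1)) 2) (cong (2 ℕ.^_) (sym e≡1+[e∸1])))) (pow-Q a))

  sqrt-≢0 : ∀ {a} → ¬ a ≡ 0# → ¬ sqrt a ≡ 0#
  sqrt-≢0 = pow-≢0 (2 ℕ.^ (e ∸ 1))

  -- A nonzero root of α D² + β D is β / α ∈ 𝔽q, on which tr is the identity as n is odd.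
  𝔽q-quadratic-root-tr≡0⇒≡0 : ∀ α β D → ¬ α ≡ 0# → 𝔽q α → 𝔽q β →
    α * (D * D) + β * D ≡ 0# → tr D ≡ 0# → D ≡ 0#
  𝔽q-quadratic-root-tr≡0⇒≡0 α β D α≢0 α∈ β∈ quadratic trD≡0 with x*y≡0⇒x≡0⊎y≡0 D[D+β/α]≡0
    where
      open ≡-Reasoning
      D[D+β/α]≡0 : D * (D + β * inv α) ≡ 0#
      D[D+β/α]≡0 = *-cancelˡ α≢0 (begin
          α * (D * (D + β * inv α))             ≡⟨ solve 4 (λ α β i D → α :* (D :* (D :+ β :* i)) := α :* (D :* D) :+ (α :* i) :* (β :* D)) refl α β (inv α) D ⟩
          α * (D * D) + (α * inv α) * (β * D)   ≡⟨ cong (λ z → α * (D * D) + z * (β * D)) (x*inv≡1 α≢0) ⟩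
          α * (D * D) + 1# * (β * D)            ≡⟨ cong (α * (D * D) +_) (*-identityˡ _) ⟩
          α * (D * D) + β * D                   ≡⟨ quadratic ⟩
          0#                                    ≡⟨ sym (zeroʳ α) ⟩
          α * 0#                                ∎)
  ... | inj₁ D≡0 = D≡0
  ... | inj₂ D+β/α≡0 = trans D≡β/α (trans (sym (tr-on-𝔽q (𝔽q-* β∈ (𝔽q-inv α∈)))) (trans (cong tr (sym D≡β/α)) trD≡0))
    where
      D≡β/α : D ≡ β * inv α
      D≡β/α = x+y≡0⇒x≡y D+β/α≡0

  𝔽q-quadratic-injective : ∀ α β {y₁ y₂} → ¬ α ≡ 0# → 𝔽q α → 𝔽q β → tr y₁ ≡ tr y₂ →
    α * pow y₁ 2 + β * y₁ ≡ α * pow y₂ 2 + β * y₂ → y₁ ≡ y₂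
  𝔽q-quadratic-injective α β {y₁} {y₂} α≢0 α∈ β∈ tr≡ quadratic≡ =
    x+y≡0⇒x≡y (𝔽q-quadratic-root-tr≡0⇒≡0 α β (y₁ + y₂) α≢0 α∈ β∈ quadratic-at-sum (trans (tr-+ y₁ y₂) (x≡y⇒x+y≡0 tr≡)))
    where
      quadratic-at-sum : α * ((y₁ + y₂) * (y₁ + y₂)) + β * (y₁ + y₂) ≡ 0#
      quadratic-at-sum = trans
        (solve 4 (λ α β a b → α :* ((a :+ b) :* (a :+ b)) :+ β :* (a :+ b) := (α :* (a :* a) :+ β :* a) :+ (α :* (b :* b) :+ β :* b)) refl α β y₁ y₂)
        (trans (cong₂ (λ a b → (α * a + β * y₁) + (α * b + β * y₂)) (sym (pow-2 y₁)) (sym (pow-2 y₂))) (x≡y⇒x+y≡0 quadratic≡))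

  tr-scaled⇒tr-injective : ∀ (f : Carrier → Carrier) {k} → ¬ k ≡ 0# → (∀ x → tr (f x) ≡ tr x * k) →
    ∀ {x₁ x₂} → f x₁ ≡ f x₂ → tr x₁ ≡ tr x₂
  tr-scaled⇒tr-injective f {k} k≢0 tr-f {x₁} {x₂} f≡ = *-cancelˡ k≢0 (begin
      k * tr x₁      ≡⟨ *-comm k _ ⟩
      tr x₁ * k      ≡⟨ sym (tr-f x₁) ⟩
      tr (f x₁)      ≡⟨ cong tr f≡ ⟩
      tr (f x₂)      ≡⟨ tr-f x₂ ⟩
      tr x₂ * k      ≡⟨ *-comm _ k ⟩
      k * tr x₂      ∎)
    where open ≡-Reasoning

  module Coefficients (u v : Carrier) (u∈ : 𝔽q u) (u≢0 : ¬ u ≡ 0#) (v∈ : 𝔽q v) (v≢0 : ¬ v ≡ 0#) where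
    w : Carrier
    w = inv v

    v*w≡1 : v * w ≡ 1#
    v*w≡1 = x*inv≡1 v≢0

    W : Carrier → Carrier
    W t = u * pow t 2 + pow v 2 * t

    a : ℕ → Carrier
    a j = pow u (2 ℕ.^ j ∸ 1) * inv (pow v (2 ℕ.^ suc j ∸ 1))

    A : Carrier → Carrier
    A x = sumBelow m (λ j → a j * frob j (S x))

    c : Carrier → Carrier
    c t = (u * t + pow v 2) * inv (sqrt u * v)

    b : Carrier → ℕ → Carrier
    b t j = pow (inv (c t)) (2 ℕ.^ suc j ∸ 1)

    B : Carrier → Carrier
    B x = sumBelow m (λ j → b (tr x) j * frob j (S x))

    Ftilde-at : ∀ x {p r} → pow (tr x) (q ∸ 1) ≡ p → pow (W (tr x)) (q ∸ 1) ≡ r →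
      Ftilde u v x ≡ (1# + p) * A x + (p + r) * sqrt (x * inv u) + r * (tr x * w + sqrt u * B x)
    Ftilde-at x {p} {r} T^[q∸1]≡p W^[q∸1]≡r = cong₂ (λ p r → (1# + p) * A x + (p + r) * sqrt (x * inv u) + r * (tr x * w + sqrt u * B x))
      T^[q∸1]≡p (trans (cong (λ y → pow (u * y + pow v 2 * tr x) (q ∸ 1)) (tr-frob 1 x)) W^[q∸1]≡r)

    a∈𝔽q : ∀ j → 𝔽q (a j)
    a∈𝔽q j = 𝔽q-* (𝔽q-pow (2 ℕ.^ j ∸ 1) u∈) (𝔽q-inv (𝔽q-pow (2 ℕ.^ suc j ∸ 1) v∈))

    u*a²≡v*a[1+j] : ∀ j → u * pow (a j) 2 ≡ v * a (suc j)
    u*a²≡v*a[1+j] j = begin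
        u * pow (uʲ * inv (pow v k)) 2          ≡⟨ cong (λ z → u * pow (uʲ * z) 2) (inv-pow v k) ⟩
        u * pow (uʲ * wᵏ) 2                     ≡⟨ cong (u *_) (pow-distrib-* uʲ wᵏ 2) ⟩
        u * (pow uʲ 2 * pow wᵏ 2)               ≡⟨ sym (*-identityˡ _) ⟩
        1# * (u * (pow uʲ 2 * pow wᵏ 2))        ≡⟨ cong (_* (u * (pow uʲ 2 * pow wᵏ 2))) (sym v*w≡1) ⟩
        (v * w) * (u * (pow uʲ 2 * pow wᵏ 2))
          ≡⟨ solve 5 (λ v w u x y → (v :* w) :* (u :* (x :* y)) := v :* ((u :* x) :* (w :* y))) refl v w u (pow uʲ 2) (pow wᵏ 2) ⟩
        v * ((u * pow uʲ 2) * (w * pow wᵏ 2))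
          ≡⟨ cong₂ (λ y z → v * (y * z)) (sym (pow[2^[1+j]∸1] j u)) (sym (pow[2^[1+j]∸1] (suc j) w)) ⟩
        v * (pow u k * pow w (2 ℕ.^ suc (suc j) ∸ 1))
          ≡⟨ cong (λ z → v * (pow u k * z)) (sym (inv-pow v (2 ℕ.^ suc (suc j) ∸ 1))) ⟩
        v * a (suc j)                           ∎
      where
        open ≡-Reasoning
        k = 2 ℕ.^ suc j ∸ 1
        uʲ = pow u (2 ℕ.^ j ∸ 1)
        wᵏ = pow w k

    v*a[m]≡1 : v * a m ≡ 1#
    v*a[m]≡1 = begin
        v * (pow u (q ∸ 1) * inv (pow v (2 ℕ.^ suc m ∸ 1)))
          ≡⟨ cong₂ (λ y z → v * (y * z)) (𝔽q-pow[q∸1] u∈ u≢0) (inv-pow v (2 ℕ.^ suc m ∸ 1)) ⟩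
        v * (1# * pow w (2 ℕ.^ suc m ∸ 1))
          ≡⟨ cong (λ z → v * (1# * z)) (trans (pow[2^[1+j]∸1] m w) (cong (λ z → w * pow z 2) (𝔽q-pow[q∸1] (𝔽q-inv v∈) (inv-≢0 v≢0)))) ⟩
        v * (1# * (w * pow 1# 2))
          ≡⟨ cong (v *_) (trans (*-identityˡ _) (trans (cong (w *_) (pow-1# 2)) (*-identityʳ w))) ⟩
        v * w                                   ≡⟨ v*w≡1 ⟩
        1#                                      ∎
      where open ≡-Reasoning

    v*a[0]≡1 : v * a 0 ≡ 1#
    v*a[0]≡1 = trans (cong (v *_) (trans (*-identityˡ _) (cong inv (*-identityʳ v)))) v*w≡1

    u*A²+v*A≡x+tr : ∀ x → u * pow (A x) 2 + v * A x ≡ x + tr x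
    u*A²+v*A≡x+tr x = trans (linearised-telescope m a u v (S x) u*a²≡v*a[1+j] v*a[m]≡1 v*a[0]≡1)
      (trans (+-comm _ _) (S+S^q≡x+tr x))

    tr-A : ∀ x → tr (A x) ≡ sumBelow m (λ j → a j * frob j (sumBelow (suc h) (λ _ → tr x)))
    tr-A x = trans (tr-linearised m a (S x) a∈𝔽q) (sumBelow-cong m (λ j → cong (λ y → a j * frob j y) (tr-S x)))

    u*sqrt[x/u]²≡x : ∀ x → u * pow (sqrt (x * inv u)) 2 ≡ x
    u*sqrt[x/u]²≡x x = trans (cong (u *_) (sqrt² _)) (trans (solve 3 (λ u x i → u :* (x :* i) := x :* (u :* i)) refl u x (inv u))
      (trans (cong (x *_) (x*inv≡1 u≢0)) (*-identityʳ x)))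

    tr-sqrt[x/u] : ∀ x → W (tr x) ≡ 0# → tr (sqrt (x * inv u)) ≡ tr x * w
    tr-sqrt[x/u] x W≡0 = pow-2-injective (*-cancelˡ (*-≢0 u≢0 (pow-≢0 2 v≢0)) (begin
        (u * v²) * pow (tr y) 2          ≡⟨ cong ((u * v²) *_) (sym (tr-frob 1 y)) ⟩
        (u * v²) * tr (pow y 2)          ≡⟨ cong (λ z → (u * v²) * tr z) (trans (sqrt² _) (*-comm x (inv u))) ⟩
        (u * v²) * tr (inv u * x)        ≡⟨ cong ((u * v²) *_) (tr-*ˡ x (𝔽q-inv u∈)) ⟩
        (u * v²) * (inv u * T)           ≡⟨ solve 4 (λ u v² i t → (u :* v²) :* (i :* t) := (u :* i) :* (v² :* t)) refl u v² (inv u) T ⟩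
        (u * inv u) * (v² * T)           ≡⟨ trans (cong (_* (v² * T)) (x*inv≡1 u≢0)) (*-identityˡ _) ⟩
        v² * T                           ≡⟨ sym (x+y≡0⇒x≡y W≡0) ⟩
        u * pow T 2                      ≡⟨ sym (*-identityˡ _) ⟩
        1# * (u * pow T 2)               ≡⟨ cong (_* (u * pow T 2)) (sym (pow-1# 2)) ⟩
        pow 1# 2 * (u * pow T 2)         ≡⟨ cong (λ z → pow z 2 * (u * pow T 2)) (sym v*w≡1) ⟩
        pow (v * w) 2 * (u * pow T 2)    ≡⟨ cong (_* (u * pow T 2)) (pow-distrib-* v w 2) ⟩
        (v² * pow w 2) * (u * pow T 2)   ≡⟨ solve 4 (λ a b u c → (a :* b) :* (u :* c) := (u :* a) :* (c :* b)) refl v² (pow w 2) u (pow T 2) ⟩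
        (u * v²) * (pow T 2 * pow w 2)   ≡⟨ cong ((u * v²) *_) (sym (pow-distrib-* T w 2)) ⟩
        (u * v²) * pow (T * w) 2         ∎))
      where
        open ≡-Reasoning
        T = tr x
        y = sqrt (x * inv u)
        v² = pow v 2

    module GenericTrace (t : Carrier) (t∈ : 𝔽q t) (W≢0 : ¬ W t ≡ 0#) where
      N : Carrier
      N = u * t + pow v 2

      W≡t*N : W t ≡ t * N
      W≡t*N = trans (cong (λ z → u * z + pow v 2 * t) (pow-2 t))
        (solve 3 (λ u t v² → u :* (t :* t) :+ v² :* t := t :* (u :* t :+ v²)) refl u t (pow v 2))

      N≢0 : ¬ N ≡ 0#
      N≢0 N≡0 = W≢0 (trans W≡t*N (trans (cong (t *_) N≡0) (zeroʳ t)))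

      N∈𝔽q : 𝔽q N
      N∈𝔽q = 𝔽q-+ (𝔽q-* u∈ t∈) (𝔽q-pow 2 v∈)

      √u*v≢0 : ¬ sqrt u * v ≡ 0#
      √u*v≢0 = *-≢0 (sqrt-≢0 u≢0) v≢0

      c≢0 : ¬ c t ≡ 0#
      c≢0 = *-≢0 N≢0 (inv-≢0 √u*v≢0)

      c∈𝔽q : 𝔽q (c t)
      c∈𝔽q = 𝔽q-* N∈𝔽q (𝔽q-inv (𝔽q-* (𝔽q-sqrt u∈) v∈))

      d : Carrier
      d = inv (c t)

      d∈𝔽q : 𝔽q d
      d∈𝔽q = 𝔽q-inv c∈𝔽q

      c*d≡1 : c t * d ≡ 1#
      c*d≡1 = x*inv≡1 c≢0

      c*d*x≡x : ∀ x → c t * (d * x) ≡ x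
      c*d*x≡x x = trans (sym (*-assoc _ d x)) (trans (cong (_* x) c*d≡1) (*-identityˡ x))

      b∈𝔽q : ∀ j → 𝔽q (b t j)
      b∈𝔽q j = 𝔽q-pow (2 ℕ.^ suc j ∸ 1) d∈𝔽q

      b²≡c*b[1+j] : ∀ j → 1# * pow (b t j) 2 ≡ c t * b t (suc j)
      b²≡c*b[1+j] j = trans (*-identityˡ _) (trans (sym (c*d*x≡x _)) (cong (c t *_) (sym (pow[2^[1+j]∸1] (suc j) d))))

      c*b[m]≡1 : c t * b t m ≡ 1#
      c*b[m]≡1 = trans (cong (c t *_) d^[2q∸1]≡d) c*d≡1
        where
          d^[2q∸1]≡d : pow d (2 ℕ.^ suc m ∸ 1) ≡ d
          d^[2q∸1]≡d = trans (pow[2^[1+j]∸1] m d)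
            (trans (cong (λ z → d * pow z 2) (𝔽q-pow[q∸1] d∈𝔽q (inv-≢0 c≢0))) (trans (cong (d *_) (pow-1# 2)) (*-identityʳ d)))

      c*b[0]≡1 : c t * b t 0 ≡ 1#
      c*b[0]≡1 = trans (cong (c t *_) (*-identityʳ d)) c*d≡1

      -- The choice of c makes d² t an Artin–Schreier value a' + a'² with a' ∈ 𝔽q.
      a' : Carrier
      a' = pow v 2 * inv N

      d²*t≡a'+a'² : pow d 2 * t ≡ a' + pow a' 2
      d²*t≡a'+a'² = begin
          pow d 2 * t                            ≡⟨ cong (λ z → pow z 2 * t) (trans (inv-distrib-* N _) (cong (inv N *_) (inv-involutive √u*v≢0))) ⟩
          pow (N⁻¹ * (sqrt u * v)) 2 * t         ≡⟨ cong (_* t) (trans (pow-distrib-* N⁻¹ _ 2) (cong (pow N⁻¹ 2 *_)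
                                                      (trans (pow-distrib-* (sqrt u) v 2) (cong (_* v²) (sqrt² u))))) ⟩
          (pow N⁻¹ 2 * (u * v²)) * t             ≡⟨ cong (λ z → (z * (u * v²)) * t) (pow-2 N⁻¹) ⟩
          ((N⁻¹ * N⁻¹) * (u * v²)) * t
            ≡⟨ solve 4 (λ i u v² t → ((i :* i) :* (u :* v²)) :* t := v² :* i :* (i :* (u :* t :+ v²)) :+ (v² :* i) :* (v² :* i)) refl N⁻¹ u v² t ⟩
          v² * N⁻¹ * (N⁻¹ * N) + a' * a'          ≡⟨ cong₂ (λ z y → v² * N⁻¹ * z + y) (inv*x≡1 N≢0) (sym (pow-2 a')) ⟩
          v² * N⁻¹ * 1# + pow a' 2               ≡⟨ cong (_+ pow a' 2) (*-identityʳ _) ⟩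
          a' + pow a' 2                          ∎
        where
          open ≡-Reasoning
          N⁻¹ = inv N
          v² = pow v 2

      b*frob≡c*[a'^2^[1+j]+a'^2^j] : ∀ j → b t j * frob j t ≡ c t * (frob (suc j) a' + frob j a')
      b*frob≡c*[a'^2^[1+j]+a'^2^j] j = begin
          b t j * frob j t                       ≡⟨ cong (_* frob j t) (sym (c*d*x≡x _)) ⟩
          (c t * (d * b t j)) * frob j t         ≡⟨ cong (λ z → (c t * z) * frob j t) (sym (frob≡x*pow[2^k∸1] (suc j) d)) ⟩
          (c t * frob (suc j) d) * frob j t      ≡⟨ *-assoc (c t) _ _ ⟩
          c t * (frob (suc j) d * frob j t)      ≡⟨ cong (λ z → c t * (z * frob j t)) (frob-suc j d) ⟩
          c t * (frob j (pow d 2) * frob j t)    ≡⟨ cong (c t *_) (sym (frob-* j _ t)) ⟩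
          c t * frob j (pow d 2 * t)             ≡⟨ cong (λ z → c t * frob j z) d²*t≡a'+a'² ⟩
          c t * frob j (a' + pow a' 2)           ≡⟨ cong (c t *_) (frob-+ j a' _) ⟩
          c t * (frob j a' + frob j (pow a' 2))  ≡⟨ cong (λ z → c t * (frob j a' + z)) (sym (frob-suc j a')) ⟩
          c t * (frob j a' + frob (suc j) a')    ≡⟨ cong (c t *_) (+-comm _ _) ⟩
          c t * (frob (suc j) a' + frob j a')    ∎
        where open ≡-Reasoning

      Σb*frob≡0 : sumBelow m (λ j → b t j * frob j t) ≡ 0#
      Σb*frob≡0 = begin
          sumBelow m (λ j → b t j * frob j t)                  ≡⟨ sumBelow-cong m b*frob≡c*[a'^2^[1+j]+a'^2^j] ⟩
          sumBelow m (λ j → c t * (frob (suc j) a' + frob j a')) ≡⟨ sym (*-distribˡ-sumBelow (c t) m _) ⟩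
          c t * sumBelow m (λ j → frob (suc j) a' + frob j a')   ≡⟨ cong (c t *_) (telescope m (λ j → frob j a')) ⟩
          c t * (frob m a' + frob 0 a')                          ≡⟨ cong₂ (λ y z → c t * (y + z)) a'∈𝔽q (frob-0 a') ⟩
          c t * (a' + a')                                        ≡⟨ cong (c t *_) (x+x≡0 a') ⟩
          c t * 0#                                               ≡⟨ zeroʳ (c t) ⟩
          0#                                                     ∎
        where
          open ≡-Reasoning
          a'∈𝔽q : 𝔽q a'
          a'∈𝔽q = 𝔽q-* (𝔽q-pow 2 v∈) (𝔽q-inv N∈𝔽q)

    B²+c*B≡x+tr : ∀ x → ¬ W (tr x) ≡ 0# → pow (B x) 2 + c (tr x) * B x ≡ x + tr x
    B²+c*B≡x+tr x W≢0 = trans (cong (_+ c (tr x) * B x) (sym (*-identityˡ _)))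
      (trans (linearised-telescope m (b (tr x)) 1# (c (tr x)) (S x) b²≡c*b[1+j] c*b[m]≡1 c*b[0]≡1)
             (trans (+-comm _ _) (S+S^q≡x+tr x)))
      where open GenericTrace (tr x) (tr-𝔽q x) W≢0

    tr-B : ∀ x → ¬ W (tr x) ≡ 0# → tr (B x) ≡ 0#
    tr-B x W≢0 = trans (tr-linearised m (b (tr x)) (S x) b∈𝔽q)
      (trans (sumBelow-cong m (λ j → cong (λ y → b (tr x) j * frob j y) (tr-S x))) Σ≡0)
      where
        open GenericTrace (tr x) (tr-𝔽q x) W≢0
        Σ≡0 : sumBelow m (λ j → b (tr x) j * frob j (sumBelow (suc h) (λ _ → tr x))) ≡ 0#
        Σ≡0 with sumBelow-const≡0⊎a (suc h) (tr x)
        ... | inj₁ ≡0 = trans (sumBelow-cong m (λ j → trans (cong (λ y → b (tr x) j * frob j y) ≡0)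
                          (trans (cong (b (tr x) j *_) (frob-0# j)) (zeroʳ _)))) (sumBelow-0# m)
        ... | inj₂ ≡T = trans (sumBelow-cong m (λ j → cong (λ y → b (tr x) j * frob j y) ≡T)) Σb*frob≡0

    data Branch (t : Carrier) : Set where
      trace-zero : t ≡ 0# → Branch t
      W-root     : ¬ t ≡ 0# → W t ≡ 0# → Branch t
      generic    : ¬ t ≡ 0# → ¬ W t ≡ 0# → Branch t

    branch : ∀ t → Branch t
    branch t with t ≟ 0# | W t ≟ 0#
    ... | yes t≡0 | _       = trace-zero t≡0
    ... | no t≢0 | yes W≡0 = W-root t≢0 W≡0
    ... | no t≢0 | no W≢0  = generic t≢0 W≢0

    F : Carrier → Carrier
    F = Ftilde u v

    F≡A : ∀ x → tr x ≡ 0# → F x ≡ A x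
    F≡A x T≡0 = trans (Ftilde-at x T^[q∸1]≡0 W^[q∸1]≡0)
        (solve 3 (λ a y z → (con true :+ con false) :* a :+ (con false :+ con false) :* y :+ con false :* z := a) refl (A x) _ _)
      where
        T^[q∸1]≡0 : pow (tr x) (q ∸ 1) ≡ 0#
        T^[q∸1]≡0 = trans (cong (λ z → pow z (q ∸ 1)) T≡0) 0#-pow[q∸1]
        W≡0 : W (tr x) ≡ 0#
        W≡0 = trans (cong W T≡0) (solve 2 (λ u v² → u :* (con false :* (con false :* con true)) :+ v² :* con false := con false) refl u (pow v 2))
        W^[q∸1]≡0 : pow (W (tr x)) (q ∸ 1) ≡ 0#
        W^[q∸1]≡0 = trans (cong (λ z → pow z (q ∸ 1)) W≡0) 0#-pow[q∸1]

    F≡sqrt[x/u] : ∀ x → ¬ tr x ≡ 0# → W (tr x) ≡ 0# → F x ≡ sqrt (x * inv u)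
    F≡sqrt[x/u] x T≢0 W≡0 = trans (Ftilde-at x (𝔽q-pow[q∸1] (tr-𝔽q x) T≢0) (trans (cong (λ z → pow z (q ∸ 1)) W≡0) 0#-pow[q∸1]))
      (solve 3 (λ a y z → (con true :+ con true) :* a :+ (con true :+ con false) :* y :+ con false :* z := y) refl (A x) _ _)

    F≡T*w+√u*B : ∀ x → ¬ tr x ≡ 0# → ¬ W (tr x) ≡ 0# → F x ≡ tr x * w + sqrt u * B x
    F≡T*w+√u*B x T≢0 W≢0 = trans (Ftilde-at x (𝔽q-pow[q∸1] (tr-𝔽q x) T≢0) (𝔽q-pow[q∸1] W∈𝔽q W≢0))
      (solve 3 (λ a y z → (con true :+ con true) :* a :+ (con true :+ con true) :* y :+ con true :* z := z) refl (A x) _ _)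
      where
        W∈𝔽q : 𝔽q (W (tr x))
        W∈𝔽q = 𝔽q-+ (𝔽q-* u∈ (𝔽q-pow 2 (tr-𝔽q x))) (𝔽q-* (𝔽q-pow 2 v∈) (tr-𝔽q x))

    x≡u*F²+v*F : ∀ x → tr x ≡ 0# → x ≡ u * pow (F x) 2 + v * F x
    x≡u*F²+v*F x T≡0 = trans (sym (trans (u*A²+v*A≡x+tr x) (trans (cong (x +_) T≡0) (+-identityʳ x))))
      (cong (λ y → u * pow y 2 + v * y) (sym (F≡A x T≡0)))

    x≡u*F² : ∀ x → ¬ tr x ≡ 0# → W (tr x) ≡ 0# → x ≡ u * pow (F x) 2
    x≡u*F² x T≢0 W≡0 = trans (sym (u*sqrt[x/u]²≡x x)) (cong (λ y → u * pow y 2) (sym (F≡sqrt[x/u] x T≢0 W≡0)))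

    x≡B²+c*B+T : ∀ x → ¬ W (tr x) ≡ 0# → x ≡ pow (B x) 2 + c (tr x) * B x + tr x
    x≡B²+c*B+T x W≢0 = sym (trans (cong (_+ tr x) (B²+c*B≡x+tr x W≢0)) (solve 2 (λ x t → x :+ t :+ t := x) refl x (tr x)))

    √u*B≡F+T*w : ∀ x → ¬ tr x ≡ 0# → ¬ W (tr x) ≡ 0# → sqrt u * B x ≡ F x + tr x * w
    √u*B≡F+T*w x T≢0 W≢0 = trans (solve 2 (λ y z → z := (y :+ z) :+ y) refl (tr x * w) (sqrt u * B x))
      (cong (_+ tr x * w) (sym (F≡T*w+√u*B x T≢0 W≢0)))

    tr-F : ∀ x → tr (F x) ≡ tr x * w
    tr-F x with branch (tr x)
    ... | trace-zero T≡0 = begin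
        tr (F x)   ≡⟨ trans (cong tr (F≡A x T≡0)) (tr-A x) ⟩
        sumBelow m (λ j → a j * frob j (sumBelow (suc h) (λ _ → tr x)))
          ≡⟨ sumBelow-cong m (λ j → cong (λ y → a j * frob j y) (trans (sumBelow-cong (suc h) (λ _ → T≡0)) (sumBelow-0# (suc h)))) ⟩
        sumBelow m (λ j → a j * frob j 0#)  ≡⟨ sumBelow-cong m (λ j → trans (cong (a j *_) (frob-0# j)) (zeroʳ _)) ⟩
        sumBelow m (λ _ → 0#)               ≡⟨ sumBelow-0# m ⟩
        0#                                  ≡⟨ sym (trans (cong (_* w) T≡0) (zeroˡ w)) ⟩
        tr x * w                            ∎
      where open ≡-Reasoning
    ... | W-root T≢0 W≡0 = trans (cong tr (F≡sqrt[x/u] x T≢0 W≡0)) (tr-sqrt[x/u] x W≡0)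
    ... | generic T≢0 W≢0 = begin
        tr (F x)                            ≡⟨ trans (cong tr (F≡T*w+√u*B x T≢0 W≢0)) (tr-+ _ _) ⟩
        tr (tr x * w) + tr (sqrt u * B x)   ≡⟨ cong₂ _+_ (tr-on-𝔽q (𝔽q-* (tr-𝔽q x) (𝔽q-inv v∈))) (tr-*ˡ (B x) (𝔽q-sqrt u∈)) ⟩
        tr x * w + sqrt u * tr (B x)        ≡⟨ cong (λ y → tr x * w + sqrt u * y) (tr-B x W≢0) ⟩
        tr x * w + sqrt u * 0#              ≡⟨ trans (cong (tr x * w +_) (zeroʳ _)) (+-identityʳ _) ⟩
        tr x * w                            ∎
      where open ≡-Reasoning

    x-determined-by-B : ∀ {x₁ x₂} → ¬ W (tr x₁) ≡ 0# → tr x₁ ≡ tr x₂ → B x₁ ≡ B x₂ → x₁ ≡ x₂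
    x-determined-by-B {x₁} {x₂} W≢0 T≡ B≡ = begin
        x₁                                       ≡⟨ x≡B²+c*B+T x₁ W≢0 ⟩
        pow (B x₁) 2 + c (tr x₁) * B x₁ + tr x₁  ≡⟨ cong₂ (λ y t → pow y 2 + c t * y + t) B≡ T≡ ⟩
        pow (B x₂) 2 + c (tr x₂) * B x₂ + tr x₂  ≡⟨ sym (x≡B²+c*B+T x₂ (subst (λ t → ¬ W t ≡ 0#) T≡ W≢0)) ⟩
        x₂                                       ∎
      where open ≡-Reasoning

    F-injective : Injective _≡_ _≡_ F
    F-injective {x₁} {x₂} F≡ = from-branch (branch (tr x₁))
      where
        open ≡-Reasoning
        T≡ : tr x₁ ≡ tr x₂
        T≡ = tr-scaled⇒tr-injective F (inv-≢0 v≢0) tr-F F≡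
        from-branch : Branch (tr x₁) → x₁ ≡ x₂
        from-branch (trace-zero T≡0) = begin
          x₁                            ≡⟨ x≡u*F²+v*F x₁ T≡0 ⟩
          u * pow (F x₁) 2 + v * F x₁   ≡⟨ cong (λ y → u * pow y 2 + v * y) F≡ ⟩
          u * pow (F x₂) 2 + v * F x₂   ≡⟨ sym (x≡u*F²+v*F x₂ (trans (sym T≡) T≡0)) ⟩
          x₂                            ∎
        from-branch (W-root T≢0 W≡0) = begin
          x₁                            ≡⟨ x≡u*F² x₁ T≢0 W≡0 ⟩
          u * pow (F x₁) 2              ≡⟨ cong (λ y → u * pow y 2) F≡ ⟩
          u * pow (F x₂) 2              ≡⟨ sym (x≡u*F² x₂ (λ T₂≡0 → T≢0 (trans T≡ T₂≡0)) (subst (λ t → W t ≡ 0#) T≡ W≡0)) ⟩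
          x₂                            ∎
        from-branch (generic T≢0 W≢0) = x-determined-by-B W≢0 T≡ (*-cancelˡ (sqrt-≢0 u≢0) (begin
          sqrt u * B x₁       ≡⟨ √u*B≡F+T*w x₁ T≢0 W≢0 ⟩
          F x₁ + tr x₁ * w    ≡⟨ cong₂ (λ y t → y + t * w) F≡ T≡ ⟩
          F x₂ + tr x₂ * w    ≡⟨ sym (√u*B≡F+T*w x₂ (subst (λ t → ¬ t ≡ 0#) T≡ T≢0) (subst (λ t → ¬ W t ≡ 0#) T≡ W≢0)) ⟩
          sqrt u * B x₂       ∎))

    module Shifted (v≢1 : ¬ v ≡ 1#) where
      G : Carrier → Carrier
      G x = F x + x

      w+1≢0 : ¬ w + 1# ≡ 0#
      w+1≢0 w+1≡0 = v≢1 (trans (sym (*-identityʳ v)) (trans (cong (v *_) (sym (x+y≡0⇒x≡y w+1≡0))) v*w≡1))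

      tr-G : ∀ x → tr (G x) ≡ tr x * (w + 1#)
      tr-G x = trans (tr-+ (F x) x) (trans (cong (_+ tr x) (tr-F x))
        (solve 2 (λ t w → t :* w :+ t := t :* (w :+ con true)) refl (tr x) w))

      G≡u*F²+[v+1]*F : ∀ x → tr x ≡ 0# → G x ≡ u * pow (F x) 2 + (v + 1#) * F x
      G≡u*F²+[v+1]*F x T≡0 = trans (cong (F x +_) (x≡u*F²+v*F x T≡0))
        (solve 4 (λ u v y y² → y :+ (u :* y² :+ v :* y) := u :* y² :+ (v :+ con true) :* y) refl u v (F x) (pow (F x) 2))

      G≡u*F²+F : ∀ x → ¬ tr x ≡ 0# → W (tr x) ≡ 0# → G x ≡ u * pow (F x) 2 + 1# * F x
      G≡u*F²+F x T≢0 W≡0 = trans (cong (F x +_) (x≡u*F² x T≢0 W≡0))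
        (solve 3 (λ u y y² → y :+ u :* y² := u :* y² :+ con true :* y) refl u (F x) (pow (F x) 2))

      G≡B²+[√u+c]*B+T*[w+1] : ∀ x → ¬ tr x ≡ 0# → ¬ W (tr x) ≡ 0# →
        G x ≡ (1# * pow (B x) 2 + (sqrt u + c (tr x)) * B x) + tr x * (w + 1#)
      G≡B²+[√u+c]*B+T*[w+1] x T≢0 W≢0 = trans (cong₂ _+_ (F≡T*w+√u*B x T≢0 W≢0) (x≡B²+c*B+T x W≢0))
        (solve 6 (λ t w s y y² c → (t :* w :+ s :* y) :+ (y² :+ c :* y :+ t) := (con true :* y² :+ (s :+ c) :* y) :+ t :* (w :+ con true))
          refl (tr x) w (sqrt u) (B x) (pow (B x) 2) (c (tr x)))

      G-injective : Injective _≡_ _≡_ G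
      G-injective {x₁} {x₂} G≡ = from-branch (branch (tr x₁))
        where
          open ≡-Reasoning
          T≡ : tr x₁ ≡ tr x₂
          T≡ = tr-scaled⇒tr-injective G w+1≢0 tr-G G≡
          trF≡ : tr (F x₁) ≡ tr (F x₂)
          trF≡ = trans (tr-F x₁) (trans (cong (_* w) T≡) (sym (tr-F x₂)))
          from-branch : Branch (tr x₁) → x₁ ≡ x₂
          from-branch (trace-zero T≡0) = F-injective (𝔽q-quadratic-injective u (v + 1#) u≢0 u∈ (𝔽q-+ v∈ 𝔽q-1#) trF≡ (begin
            u * pow (F x₁) 2 + (v + 1#) * F x₁  ≡⟨ sym (G≡u*F²+[v+1]*F x₁ T≡0) ⟩
            G x₁                                ≡⟨ G≡ ⟩
            G x₂                                ≡⟨ G≡u*F²+[v+1]*F x₂ (trans (sym T≡) T≡0) ⟩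
            u * pow (F x₂) 2 + (v + 1#) * F x₂  ∎))
          from-branch (W-root T≢0 W≡0) = F-injective (𝔽q-quadratic-injective u 1# u≢0 u∈ 𝔽q-1# trF≡ (begin
            u * pow (F x₁) 2 + 1# * F x₁  ≡⟨ sym (G≡u*F²+F x₁ T≢0 W≡0) ⟩
            G x₁                          ≡⟨ G≡ ⟩
            G x₂                          ≡⟨ G≡u*F²+F x₂ (subst (λ t → ¬ t ≡ 0#) T≡ T≢0) (subst (λ t → W t ≡ 0#) T≡ W≡0) ⟩
            u * pow (F x₂) 2 + 1# * F x₂  ∎))
          from-branch (generic T≢0 W≢0) = x-determined-by-B W≢0 T≡ (𝔽q-quadratic-injective 1# β 1≢0 𝔽q-1#
              (𝔽q-+ (𝔽q-sqrt u∈) (GenericTrace.c∈𝔽q (tr x₁) (tr-𝔽q x₁) W≢0))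
              (trans (tr-B x₁ W≢0) (sym (tr-B x₂ W₂≢0))) (+-cancelʳ (tr x₁ * (w + 1#)) (begin
                (1# * pow (B x₁) 2 + β * B x₁) + tr x₁ * (w + 1#)  ≡⟨ sym (G≡B²+[√u+c]*B+T*[w+1] x₁ T≢0 W≢0) ⟩
                G x₁                                               ≡⟨ G≡ ⟩
                G x₂                                               ≡⟨ G≡B²+[√u+c]*B+T*[w+1] x₂ (subst (λ t → ¬ t ≡ 0#) T≡ T≢0) W₂≢0 ⟩
                (1# * pow (B x₂) 2 + (sqrt u + c (tr x₂)) * B x₂) + tr x₂ * (w + 1#)
                  ≡⟨ cong (λ t → (1# * pow (B x₂) 2 + (sqrt u + c t) * B x₂) + t * (w + 1#)) (sym T≡) ⟩
                (1# * pow (B x₂) 2 + β * B x₂) + tr x₁ * (w + 1#)  ∎)))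
            where
              β = sqrt u + c (tr x₁)
              W₂≢0 : ¬ W (tr x₂) ≡ 0#
              W₂≢0 = subst (λ t → ¬ W t ≡ 0#) T≡ W≢0

open import Data.Nat using (_≤_; _^_; _*_)

corollary11 : (m n : ℕ) → 1 ≤ m → n % 2 ≡ 1 →
    (K : FiniteField (2 ^ (n * m))) →
    let open FiniteField K
        open FieldOps K
    in (u v : Carrier) →
       pow u (2 ^ m) ≡ u → ¬ (u ≡ 0#) →
       pow v (2 ^ m) ≡ v → ¬ (v ≡ 0#) → ¬ (v ≡ 1#) →
       IsCPP (Corollary11Poly.Ftilde m n K u v)
corollary11 m n 1≤m n-odd K u v u∈𝔽q u≢0 v∈𝔽q v≢0 v≢1 =
    injective⇒bijective F F-injective , injective⇒bijective G G-injective
  where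
    open FiniteFieldProperties K using (injective⇒bijective)
    open Corollary11Proof m n 1≤m n-odd K
    open Coefficients u v u∈𝔽q u≢0 v∈𝔽q v≢0
    open Shifted v≢1
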